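{- Let $R$ be an integral domain of characteristic $0$, and identify $\mathbb{N}$ with its image $\{0,1,1+1,\ldots\}\subseteq R$. Let $\mathcal{F}\subseteq\mathcal{P}(R)$ be a family of subsets of $R$ which is uniformly parametrised by a first-order formula $\phi(x;y_1,\ldots,y_k)$ in the language of rings $\{+,\cdot;0,1\}$, i.e. for every $F\subseteq R$, $$F\in\mathcal{F}\iff \exists\,\bar y\in R^k\ \forall x\in R\ \big[x\in F\leftrightarrow R\models\phi(x;\bar y)\big].$$ Assume that every $F\in\mathcal{F}$ is finite and that for every $n\in\mathbb{N}$ the initial segment $\{0,1,\ldots,n\}$ belongs to $\mathcal{F}$. Then $\mathbb{N}$ is a definable subset of $R$ in the first-order language of rings.
   Context: Definable means: there is a first-order formula $\psi(x)$ in the language of rings $\{+,\cdot;0,1\}$ such that $\mathbb{N}=\{a\in R\mid R\models\psi(a)\}$. -}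

module Defs where

open import Level using (Level; _⊔_; Lift)
open import Data.Nat using (ℕ; zero; suc; _≤_)
open import Data.Fin using (Fin)
open import Data.Vec using (Vec; _∷_; lookup)
open import Data.List using (List)
open import Data.List.Relation.Unary.Any using (Any)
open import Data.Product using (Σ; ∃; _×_)
open import Data.Sum using (_⊎_)
open import Data.Empty using (⊥)
open import Relation.Nullary using (¬_)
open import Function.Bundles using (_⇔_)
open import Algebra.Bundles using (CommutativeRing)

data Term (n : ℕ) : Set where
  var  : Fin n → Term n
  zer  : Term n
  one  : Term n
  _⊕_  : Term n → Term n → Term n
  _⊗_  : Term n → Term n → Term n

-- First-order formulas of the language of rings with n free variables.
-- Variable 0 is bound by the innermost quantifier.
data Formula (n : ℕ) : Set where
  _≐_  : Term n → Term n → Formula n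
  ff   : Formula n
  _∧_  : Formula n → Formula n → Formula n
  _∨_  : Formula n → Formula n → Formula n
  _⇒_  : Formula n → Formula n → Formula n
  ∼_   : Formula n → Formula n
  all  : Formula (suc n) → Formula n
  ex   : Formula (suc n) → Formula n

module _ {c ℓ : Level} (R : CommutativeRing c ℓ) where
  open CommutativeRing R

  ⟦_⟧ : {n : ℕ} → Term n → Vec Carrier n → Carrier
  ⟦ var i ⟧ ρ = lookup ρ i
  ⟦ zer ⟧ ρ = 0#
  ⟦ one ⟧ ρ = 1#
  ⟦ s ⊕ t ⟧ ρ = ⟦ s ⟧ ρ + ⟦ t ⟧ ρ
  ⟦ s ⊗ t ⟧ ρ = ⟦ s ⟧ ρ * ⟦ t ⟧ ρ

  Sat : {n : ℕ} → Formula n → Vec Carrier n → Set (c ⊔ ℓ)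
  Sat (s ≐ t) ρ = Lift c (⟦ s ⟧ ρ ≈ ⟦ t ⟧ ρ)
  Sat ff ρ = Lift (c ⊔ ℓ) ⊥
  Sat (φ ∧ ψ) ρ = Sat φ ρ × Sat ψ ρ
  Sat (φ ∨ ψ) ρ = Sat φ ρ ⊎ Sat ψ ρ
  Sat (φ ⇒ ψ) ρ = Sat φ ρ → Sat ψ ρ
  Sat (∼ φ) ρ = ¬ Sat φ ρ
  Sat (all φ) ρ = (a : Carrier) → Sat φ (a ∷ ρ)
  Sat (ex φ) ρ = Σ Carrier λ a → Sat φ (a ∷ ρ)

  ι : ℕ → Carrier
  ι zero = 0#
  ι (suc n) = 1# + ι n

  IsIntegralDomain : Set (c ⊔ ℓ)
  IsIntegralDomain = ¬ (1# ≈ 0#) × (∀ a b → a * b ≈ 0# → a ≈ 0# ⊎ b ≈ 0#)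

  CharZero : Set ℓ
  CharZero = ∀ n → ¬ (ι (suc n) ≈ 0#)

  Finite : {p : Level} → (Carrier → Set p) → Set (c ⊔ ℓ ⊔ p)
  Finite P = Σ (List Carrier) λ xs → ∀ x → P x → Any (x ≈_) xs

  IsNat : Carrier → Set ℓ
  IsNat x = ∃ λ m → x ≈ ι m

  InitSeg : ℕ → Carrier → Set ℓ
  InitSeg n x = ∃ λ m → m ≤ n × x ≈ ι m

  Definable : {p : Level} → (Carrier → Set p) → Set (c ⊔ ℓ ⊔ p)
  Definable P = Σ (Formula 1) λ ψ → ∀ a → (P a ⇔ Sat ψ (a ∷ Data.Vec.[]))

module Submission where

-- Write S_ȳ = {x | R ⊨ φ(x; ȳ)}.  Call a subset S ⊆ R a
-- successor chain towards a if 0 ∈ S and every z ∈ S is a or has z + 1 ∈ S.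
--   * Every initial segment {0, …, m} is a successor chain towards m.
--   * If S is finite and a successor chain towards a, then a ∈ ℕ: starting at 0
--     and adding 1, either we meet a, or all of 0, 1, …, |S| lie in S, which is
--     impossible in characteristic 0 by the pigeonhole principle.
-- Hence, since every S_ȳ is finite and every {0, …, m} is some S_ȳ,
--     a ∈ ℕ  ⇔  ∃ ȳ. S_ȳ is a successor chain towards a,
-- and the right-hand side is first-order: "S_ȳ is a successor chain towards x" is
-- written out as a formula built from renamed copies of φ.

open import Defs
open import Level using (Level; _⊔_; Lift; lift; lower)
open import Data.Nat using (ℕ; zero; suc; z≤n; s≤s⁻¹)
  renaming (_+_ to _+ℕ_; _≤_ to _≤ℕ_; _<_ to _<ℕ_)
open import Data.Nat.Properties using (n<1+n; m≤n⇒m<n∨m≡n; ≤∧≢⇒<; <-irrefl)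
  renaming (_≟_ to _≟ℕ_)
open import Data.Fin using (Fin; toℕ; _↑ˡ_; _↑ʳ_) renaming (zero to fz; suc to fs)
open import Data.Fin.Properties using (pigeonhole; toℕ<n)
open import Data.Vec using (Vec; _∷_; []; _++_; lookup)
open import Data.Vec.Properties using (lookup-++ˡ; lookup-++ʳ)
open import Data.List using (List; length)
import Data.List as List
open import Data.List.Relation.Unary.Any using (Any; index)
import Data.List.Relation.Unary.Any as Any
open import Data.List.Relation.Unary.Any.Properties using (lookup-index)
open import Data.Product using (Σ; _,_; _×_)
open import Data.Product.Function.NonDependent.Propositional using (_×-⇔_)
open import Data.Sum using (_⊎_; inj₁; inj₂; [_,_]; map₂)
open import Data.Sum.Function.Propositional using (_⊎-⇔_)
open import Data.Empty using (⊥-elim)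
open import Relation.Nullary using (¬_; yes; no)
open import Relation.Binary.PropositionalEquality using (_≡_; refl; cong; cong₂)
open import Function.Bundles using (_⇔_; mk⇔; Equivalence)
open import Function.Construct.Identity using (⇔-id)
open import Function.Construct.Composition using (_⇔-∘_)
open import Function.Related.TypeIsomorphisms using (→-cong-⇔; ¬-cong-⇔)
open import Algebra.Bundles using (CommutativeRing)
import Algebra.Properties.Group as GroupProperties

open Equivalence using (to; from)

∀-⇔ : {a p q : Level} {A : Set a} {P : A → Set p} {Q : A → Set q} →
      (∀ x → P x ⇔ Q x) → ((x : A) → P x) ⇔ ((x : A) → Q x)
∀-⇔ P⇔Q = mk⇔ (λ h x → to (P⇔Q x) (h x)) (λ h x → from (P⇔Q x) (h x))

∃-⇔ : {a p q : Level} {A : Set a} {P : A → Set p} {Q : A → Set q} →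
      (∀ x → P x ⇔ Q x) → Σ A P ⇔ Σ A Q
∃-⇔ P⇔Q = mk⇔ (λ { (x , p) → x , to (P⇔Q x) p }) (λ { (x , q) → x , from (P⇔Q x) q })

Lift-⇔ : {a ℓ : Level} {A : Set a} → Lift ℓ A ⇔ A
Lift-⇔ = mk⇔ lower lift

boundedAll : {p q : Level} {Q : Set q} {P : ℕ → Set p} →
             (∀ j → Q ⊎ P j) → ∀ n → Q ⊎ (∀ j → j ≤ℕ n → P j)
boundedAll {P = P} decide zero = map₂ atZero (decide zero)
  where
  atZero : P zero → ∀ j → j ≤ℕ zero → P j
  atZero p zero z≤n = p
boundedAll {Q = Q} {P} decide (suc n) = [ inj₁ , extend ] (boundedAll decide n)
  where
  extend : (∀ j → j ≤ℕ n → P j) → Q ⊎ (∀ j → j ≤ℕ suc n → P j)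
  extend below = map₂ include (decide (suc n))
    where
    include : P (suc n) → ∀ j → j ≤ℕ suc n → P j
    include p j j≤ with m≤n⇒m<n∨m≡n j≤
    ... | inj₁ j<1+n = below j (s≤s⁻¹ j<1+n)
    ... | inj₂ refl  = p

module InRing {c ℓ : Level} (R : CommutativeRing c ℓ) where
  open CommutativeRing R renaming (refl to ≈-refl; sym to ≈-sym; trans to ≈-trans)
  open GroupProperties +-group using (∙-cancelˡ)

  renameTerm : {n m : ℕ} → (Fin n → Fin m) → Term n → Term m
  renameTerm f (var i) = var (f i)
  renameTerm f zer = zer
  renameTerm f one = one
  renameTerm f (s ⊕ t) = renameTerm f s ⊕ renameTerm f t
  renameTerm f (s ⊗ t) = renameTerm f s ⊗ renameTerm f t

  under : {n m : ℕ} → (Fin n → Fin m) → Fin (suc n) → Fin (suc m)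
  under f fz = fz
  under f (fs i) = fs (f i)

  rename : {n m : ℕ} → (Fin n → Fin m) → Formula n → Formula m
  rename f (s ≐ t) = renameTerm f s ≐ renameTerm f t
  rename f ff = ff
  rename f (φ ∧ ψ) = rename f φ ∧ rename f ψ
  rename f (φ ∨ ψ) = rename f φ ∨ rename f ψ
  rename f (φ ⇒ ψ) = rename f φ ⇒ rename f ψ
  rename f (∼ φ) = ∼ rename f φ
  rename f (all φ) = all (rename (under f) φ)
  rename f (ex φ) = ex (rename (under f) φ)

  Agree : {n m : ℕ} → (Fin n → Fin m) → Vec Carrier n → Vec Carrier m → Set c
  Agree f ρ ρ' = ∀ i → lookup ρ' (f i) ≡ lookup ρ i

  agree-under : {n m : ℕ} {f : Fin n → Fin m} {ρ : Vec Carrier n} {ρ' : Vec Carrier m} →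
                Agree f ρ ρ' → (a : Carrier) → Agree (under f) (a ∷ ρ) (a ∷ ρ')
  agree-under agree a fz = refl
  agree-under agree a (fs i) = agree i

  renameTerm-sound : {n m : ℕ} {f : Fin n → Fin m} {ρ : Vec Carrier n} {ρ' : Vec Carrier m} →
                     Agree f ρ ρ' → (t : Term n) → ⟦_⟧ R (renameTerm f t) ρ' ≡ ⟦_⟧ R t ρ
  renameTerm-sound agree (var i) = agree i
  renameTerm-sound agree zer = refl
  renameTerm-sound agree one = refl
  renameTerm-sound agree (s ⊕ t) = cong₂ _+_ (renameTerm-sound agree s) (renameTerm-sound agree t)
  renameTerm-sound agree (s ⊗ t) = cong₂ _*_ (renameTerm-sound agree s) (renameTerm-sound agree t)

  rename-sound : {n m : ℕ} {f : Fin n → Fin m} {ρ : Vec Carrier n} {ρ' : Vec Carrier m} →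
                 Agree f ρ ρ' → (φ : Formula n) → Sat R (rename f φ) ρ' ⇔ Sat R φ ρ
  rename-sound {f = f} {ρ} {ρ'} agree (s ≐ t)
    rewrite renameTerm-sound {f = f} {ρ} {ρ'} agree s
          | renameTerm-sound {f = f} {ρ} {ρ'} agree t = ⇔-id _
  rename-sound agree ff = ⇔-id _
  rename-sound agree (φ ∧ ψ) = rename-sound agree φ ×-⇔ rename-sound agree ψ
  rename-sound agree (φ ∨ ψ) = rename-sound agree φ ⊎-⇔ rename-sound agree ψ
  rename-sound agree (φ ⇒ ψ) = →-cong-⇔ (rename-sound agree φ) (rename-sound agree ψ)
  rename-sound agree (∼ φ) = ¬-cong-⇔ (rename-sound agree φ)
  rename-sound agree (all φ) = ∀-⇔ λ a → rename-sound (agree-under agree a) φ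
  rename-sound agree (ex φ) = ∃-⇔ λ a → rename-sound (agree-under agree a) φ

  ∃* : {n : ℕ} (k : ℕ) → Formula (k +ℕ n) → Formula n
  ∃* zero θ = θ
  ∃* (suc k) θ = ∃* k (ex θ)

  ∃*-sound : {n : ℕ} (k : ℕ) (θ : Formula (k +ℕ n)) (ρ : Vec Carrier n) →
             Sat R (∃* k θ) ρ ⇔ Σ (Vec Carrier k) λ ys → Sat R θ (ys ++ ρ)
  ∃*-sound zero θ ρ = mk⇔ (λ s → [] , s) (λ { ([] , s) → s })
  ∃*-sound (suc k) θ ρ = mk⇔
    (λ s → let (ys , a , t) = to (∃*-sound k (ex θ) ρ) s in a ∷ ys , t)
    (λ { (a ∷ ys , t) → from (∃*-sound k (ex θ) ρ) (ys , a , t) })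

  ι-injective : CharZero R → ∀ {m n} → ι R m ≈ ι R n → m ≡ n
  ι-injective char0 {zero}  {zero}  _ = refl
  ι-injective char0 {zero}  {suc n} e = ⊥-elim (char0 n (≈-sym e))
  ι-injective char0 {suc m} {zero}  e = ⊥-elim (char0 m e)
  ι-injective char0 {suc m} {suc n} e =
    cong suc (ι-injective char0 (∙-cancelˡ 1# _ _ e))

  ι-unlistable : CharZero R → (xs : List Carrier) →
                 ¬ (∀ j → j ≤ℕ length xs → Any (ι R j ≈_) xs)
  ι-unlistable char0 xs listed = collision (pigeonhole (n<1+n (length xs)) position)
    where
    member : (i : Fin (suc (length xs))) → Any (ι R (toℕ i) ≈_) xs
    member i = listed (toℕ i) (s≤s⁻¹ (toℕ<n i))
    position : Fin (suc (length xs)) → Fin (length xs)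
    position i = index (member i)
    samePosition : ∀ i j → position i ≡ position j → ι R (toℕ i) ≈ ι R (toℕ j)
    samePosition i j same = ≈-trans (lookup-index (member i))
      (≈-trans (reflexive (cong (List.lookup xs) same)) (≈-sym (lookup-index (member j))))
    collision : ¬ (Σ _ λ i → Σ _ λ j → toℕ i <ℕ toℕ j × position i ≡ position j)
    collision (i , j , i<j , same) = <-irrefl (ι-injective char0 (samePosition i j same)) i<j

  Contains : {p : Level} → (Carrier → Set p) → Carrier → Set (c ⊔ ℓ ⊔ p)
  Contains S x = Σ Carrier λ w → w ≈ x × S w

  Chain : {p : Level} → (Carrier → Set p) → Carrier → Set (c ⊔ ℓ ⊔ p)
  Chain S a = Contains S 0# × (∀ z → S z → z ≈ a ⊎ Contains S (1# + z))

  Chain-resp : {p q : Level} {S : Carrier → Set p} {T : Carrier → Set q} {a : Carrier} →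
               (∀ x → S x ⇔ T x) → Chain S a → Chain T a
  Chain-resp {S = S} {T} S⇔T (zero∈S , step) =
    moveContains zero∈S , λ z z∈T → map₂ moveContains (step z (from (S⇔T z) z∈T))
    where
    moveContains : ∀ {x} → Contains S x → Contains T x
    moveContains (w , w≈x , w∈S) = w , w≈x , to (S⇔T w) w∈S

  initSeg-chain : ∀ m {a} → a ≈ ι R m → Chain (InitSeg R m) a
  initSeg-chain m {a} a≈m = (0# , ≈-refl , (0 , z≤n , ≈-refl)) , step
    where
    step : ∀ z → InitSeg R m z → z ≈ a ⊎ Contains (InitSeg R m) (1# + z)
    step z (j , j≤m , z≈j) with j ≟ℕ m
    ... | yes refl = inj₁ (≈-trans z≈j (≈-sym a≈m))
    ... | no j≢m   = inj₂ (1# + z , ≈-refl , (suc j , ≤∧≢⇒< j≤m j≢m , +-congˡ z≈j))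

  chain-walk : {p : Level} {S : Carrier → Set p} {a : Carrier} →
               Chain S a → ∀ n → IsNat R a ⊎ Contains S (ι R n)
  chain-walk (zero∈S , _) zero = inj₂ zero∈S
  chain-walk {a = a} chain@(_ , step) (suc n) = [ inj₁ , advance ] (chain-walk chain n)
    where
    advance : Contains _ (ι R n) → IsNat R a ⊎ Contains _ (ι R (suc n))
    advance (w , w≈n , w∈S) with step w w∈S
    ... | inj₁ w≈a = inj₁ (n , ≈-trans (≈-sym w≈a) w≈n)
    ... | inj₂ (v , v≈1+w , v∈S) = inj₂ (v , ≈-trans v≈1+w (+-congˡ w≈n) , v∈S)

  finiteChain⇒IsNat : {p : Level} {S : Carrier → Set p} {a : Carrier} → CharZero R →
                      Finite R S → Chain S a → IsNat R a
  finiteChain⇒IsNat {S = S} char0 (xs , listed) chain =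
    [ (λ a∈ℕ → a∈ℕ) , (λ below → ⊥-elim (ι-unlistable char0 xs λ j j≤ → inList (below j j≤))) ]
      (boundedAll (chain-walk chain) (length xs))
    where
    inList : ∀ {x} → Contains S x → Any (x ≈_) xs
    inList (w , w≈x , w∈S) = Any.map (≈-trans (≈-sym w≈x)) (listed w w∈S)

  -- The formula "{z | φ(z; ȳ)} is a successor chain towards x", with free
  -- variables ȳ, x (in this order) and φ(·; ȳ) renamed into place.
  module ChainFormula (k : ℕ) (φ : Formula (suc k)) where
    target : Fin (k +ℕ 1)
    target = k ↑ʳ fz

    -- φ(z; ȳ) in the context z, ȳ, x
    inner : Fin (suc k) → Fin (suc (k +ℕ 1))
    inner i = i ↑ˡ 1

    -- φ(w; ȳ) in the context w, z, ȳ, x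
    innerSkip : Fin (suc k) → Fin (suc (suc (k +ℕ 1)))
    innerSkip = under (λ i → fs (i ↑ˡ 1))

    chainFormula : Formula (k +ℕ 1)
    chainFormula =
      ex ((var fz ≐ zer) ∧ rename inner φ) ∧
      all (rename inner φ ⇒
           ((var fz ≐ var (fs target)) ∨
            ex ((var fz ≐ (one ⊕ var (fs fz))) ∧ rename innerSkip φ)))

    chainFormula-sound : (ys : Vec Carrier k) (x : Carrier) →
      Sat R chainFormula (ys ++ x ∷ []) ⇔ Chain (λ z → Sat R φ (z ∷ ys)) x
    chainFormula-sound ys x =
      (∃-⇔ λ w → Lift-⇔ ×-⇔ φ-inner w) ×-⇔
      (∀-⇔ λ z → →-cong-⇔ (φ-inner z)
        (isTarget z ⊎-⇔ (∃-⇔ λ w → Lift-⇔ ×-⇔ φ-innerSkip w z)))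
      where
      φ-inner : ∀ z → Sat R (rename inner φ) (z ∷ ys ++ x ∷ []) ⇔ Sat R φ (z ∷ ys)
      φ-inner z = rename-sound (lookup-++ˡ (z ∷ ys) (x ∷ [])) φ
      φ-innerSkip : ∀ w z → Sat R (rename innerSkip φ) (w ∷ z ∷ ys ++ x ∷ []) ⇔ Sat R φ (w ∷ ys)
      φ-innerSkip w z = rename-sound (agree-under (lookup-++ˡ ys (x ∷ [])) w) φ
      isTarget : ∀ z → Lift c (z ≈ lookup (ys ++ x ∷ []) target) ⇔ (z ≈ x)
      isTarget z rewrite lookup-++ʳ ys (x ∷ []) fz = Lift-⇔

    chainDefinition : ∀ a → Sat R (∃* k chainFormula) (a ∷ []) ⇔
                      Σ (Vec Carrier k) λ ys → Chain (λ z → Sat R φ (z ∷ ys)) a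
    chainDefinition a = (∃-⇔ λ ys → chainFormula-sound ys a) ⇔-∘ ∃*-sound k chainFormula (a ∷ [])

mainTheorem1 : {c ℓ : Level} (R : CommutativeRing c ℓ) →
    IsIntegralDomain R → CharZero R →
    (k : ℕ) (φ : Formula (suc k)) →
    ((ys : Vec (CommutativeRing.Carrier R) k) → Finite R (λ x → Sat R φ (x ∷ ys))) →
    ((n : ℕ) → Σ (Vec (CommutativeRing.Carrier R) k) λ ys →
    (x : CommutativeRing.Carrier R) → InitSeg R n x ⇔ Sat R φ (x ∷ ys)) →
    Definable R (IsNat R)
mainTheorem1 R _ char0 k φ finite segment = ∃* k chainFormula , λ a →
  mk⇔ (λ { (m , a≈m) → from (chainDefinition a) (segmentChain m a≈m) })
      (λ s → let (ys , chain) = to (chainDefinition a) s in finiteChain⇒IsNat char0 (finite ys) chain)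
  where
  open CommutativeRing R using (Carrier; _≈_)
  open InRing R
  open ChainFormula k φ
  segmentChain : ∀ m {a} → a ≈ ι R m → Σ (Vec Carrier k) λ ys → Chain (λ z → Sat R φ (z ∷ ys)) a
  segmentChain m a≈m = let (ys , seg⇔φ) = segment m in
    ys , Chain-resp seg⇔φ (initSeg-chain m a≈m)
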